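{- Let $\Pi X.\, s\ [\exists\vec{x}.\,\varphi]$ be a satisfiable existentially constrained term. Suppose $\mathrm{PG}(\Pi X.\, s\ [\exists\vec{x}.\varphi]) = \Pi Y.\, s[w_1,\dots,w_n]_{p_1,\dots,p_n}\ [\exists\vec{y}.\psi]$ where $\{p_1,\dots,p_n\}=\mathcal{P}os_{X\cup\mathcal{V}al}(s)$, and let $\sigma=\{w_i\mapsto s|_{p_i}\mid 1\le i\le n\}$. Then $\vDash_{\mathcal{M}}(\exists\vec{x}.\varphi)\Leftrightarrow(\exists\vec{y}.\psi)\sigma$.
   Context: Fix a many-sorted signature whose sorts are partitioned into theory sorts and term sorts and whose function symbols are partitioned into theory symbols (all argument and result sorts are theory sorts) and term symbols; terms are built from these symbols and sorted variables. A fixed model $\mathcal{M}$ interprets theory sorts and theory symbols; the sort Bool is interpreted as $\{\mathsf{true},\mathsf{false}\}$, equality is available as a theory symbol, and every element of the interpretation of every theory sort is a constant symbol of the signature, called a value; $\mathcal{V}al$ is the set of values. A logical constraint is a Bool-sorted term built from theory symbols and variables. A valuation $\rho$ maps theory-sorted variables to elements of the interpretations of their sorts; $\vDash_{\mathcal{M},\rho}\varphi$ means $\varphi$ evaluates to true under $\rho$. Substitutions are sort-preserving; $\sigma|_U$ agrees with $\sigma$ on $U$ and is the identity elsewhere. $\mathcal{V}ar(\cdot)$ denotes the set of variables occurring in an expression. For a term $s$: $s|_p$ is the subterm at position $p$, $s(p)$ the symbol at $p$, $\mathcal{P}os_U(s)$ the set of positions $p$ with $s(p)\in U$, and $s[t_1,\dots,t_n]_{p_1,\dots,p_n}$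 the result of replacing the subterms at parallel positions $p_i$ by $t_i$. An existential constraint $\exists\vec{x}.\,\varphi$ is a pair of a sequence of variables $\vec{x}$ and a logical constraint $\varphi$ with $\{\vec{x}\}\subseteq\mathcal{V}ar(\varphi)$; its free variables are $\mathcal{FV}ar(\exists\vec{x}.\varphi)=\mathcal{V}ar(\varphi)\setminus\{\vec{x}\}$. $\vDash_{\mathcal{M},\rho}\exists\vec{x}.\varphi$ iff there are values $\vec{v}$ with $\vDash_{\mathcal{M},\rho}\varphi\{\vec{x}\mapsto\vec{v}\}$; it is satisfiable if this holds for some $\rho$. For a substitution $\sigma$, $(\exists\vec{x}.\varphi)\sigma := \exists\vec{x}.(\varphi\,\sigma|_{\mathcal{FV}ar(\exists\vec{x}.\varphi)})$. $\vDash_{\mathcal{M}} A\Leftrightarrow B$ means that for every valuation $\rho$, $\vDash_{\mathcal{M},\rho}A$ iff $\vDash_{\mathcal{M},\rho}B$. An existentially constrained term $\Pi X.\, s\ [\exists\vec{x}.\,\varphi]$ is a triple of a set $X$ of variables, a term $s$ and an existential constraint with $\mathcal{FV}ar(\exists\vec{x}.\varphi)\subseteq X\subseteq\mathcal{V}ar(s)$ and $\{\vec{x}\}\cap\mathcal{V}ar(s)=\emptyset$; it is satisfiable if its constraint is. PG-transformation: $\mathrm{PG}(\Pi X.\, s\ [\exists\vec{x}.\varphi]) = \Pi Y.\, t\ [\exists\vec{y}.\psi]$ where $\{p_1,\dots,p_n\}=\mathcal{P}os_{X\cup\mathcal{V}al}(s)$, $w_1,\dots,w_n$ are pairwise distinct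 fresh variables (of the sorts of $s|_{p_i}$), $Y=\{w_1,\dots,w_n\}$, $t=s[w_1,\dots,w_n]_{p_1,\dots,p_n}$, $\{\vec{y}\}=\{\vec{x}\}\cup X$, and $\psi=\varphi\wedge\bigwedge_{i=1}^n(s|_{p_i}=w_i)$.
   Formalization: In $(\exists\vec{y}.\psi)\sigma$, σ restricted to the free variables is applied to any α-variant of ∃y⃗.ψ whose bound variables are injectively renamed to names not free in it and occurring in no σ(x) with x free. Each condition added here is assumed in the paper as well or is needed for the statement above to hold. -}

module Defs where

open import Data.Nat using (ℕ; zero; suc)
open import Data.Bool using (Bool; true; false; _∧_)
open import Data.Bool.Properties renaming (_≟_ to _≟𝔹_)
open import Data.List using (List; []; _∷_; map; foldr)
open import Data.List.Relation.Unary.All using (All; []; _∷_)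
open import Data.List.Membership.Propositional using (_∈_; _∉_)
open import Data.List.Relation.Unary.Unique.Propositional using (Unique)
open import Data.Product using (Σ; _×_; _,_)
open import Data.Sum using (_⊎_)
import Data.Empty
import Data.List
open import Relation.Nullary.Decidable using (isYes)
open import Relation.Binary.PropositionalEquality using (_≡_)
open import Function.Bundles using (_⇔_)

data ThSort (B : Set) : Set where
  bool : ThSort B
  base : B → ThSort B

data Sort (B T : Set) : Set where
  th : ThSort B → Sort B T
  tm : T → Sort B T

Interp : {B : Set} → (B → Set) → ThSort B → Set
Interp I bool     = Bool
Interp I (base b) = I b

-- Signature: the non-value theory symbols (ThOp) and the term symbols
-- (TmOp).  Values, equality and conjunction are added below as built-in
-- theory symbols (values depend on the model).

record Signature : Set₁ where
  field
    BaseSort : Set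
    TmSort   : Set
    ThOp     : Set
    opArity  : ThOp → List (ThSort BaseSort)
    opRes    : ThOp → ThSort BaseSort
    TmOp     : Set
    tmArity  : TmOp → List (Sort BaseSort TmSort)
    tmRes    : TmOp → Sort BaseSort TmSort

record Model (Sg : Signature) : Set₁ where
  open Signature Sg
  field
    I     : BaseSort → Set
    opI   : (f : ThOp) → All (Interp I) (opArity f) → Interp I (opRes f)
    eqI   : (b : BaseSort) → I b → I b → Bool
    eqI-spec : (b : BaseSort) (x y : I b) → (eqI b x y ≡ true) ⇔ (x ≡ y)

module Theory (Sg : Signature) (M : Model Sg) where
  open Signature Sg public
  open Model M public

  TSort : Set
  TSort = ThSort BaseSort

  SSort : Set
  SSort = Sort BaseSort TmSort

  ⟦_⟧ : TSort → Set
  ⟦_⟧ = Interp I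

  data ThFun : Set where
    op   : ThOp → ThFun
    val  : (τ : TSort) → ⟦ τ ⟧ → ThFun
    eqF  : TSort → ThFun
    andF : ThFun

  arity : ThFun → List TSort
  arity (op f)    = opArity f
  arity (val τ v) = []
  arity (eqF τ)   = τ ∷ τ ∷ []
  arity andF      = bool ∷ bool ∷ []

  res : ThFun → TSort
  res (op f)    = opRes f
  res (val τ v) = τ
  res (eqF τ)   = bool
  res andF      = bool

  eqSem : (τ : TSort) → ⟦ τ ⟧ → ⟦ τ ⟧ → Bool
  eqSem bool     x y = isYes (x ≟𝔹 y)
  eqSem (base b) x y = eqI b x y

  interp : (f : ThFun) → All ⟦_⟧ (arity f) → ⟦ res f ⟧
  interp (op f)    vs                = opI f vs
  interp (val τ v) vs                = v
  interp (eqF τ)   (x ∷ y ∷ [])      = eqSem τ x y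
  interp andF      (x ∷ y ∷ [])      = x ∧ y

  -- Variables: a variable of sort σ is named by a natural number; as an
  -- element of the set of all variables it is the pair (σ , n).

  Var : Set
  Var = SSort × ℕ

  ThVar : Set
  ThVar = TSort × ℕ

  thv : ThVar → Var
  thv (τ , n) = (th τ , n)

  mutual
    data Term : SSort → Set where
      var   : ∀ {σ} → ℕ → Term σ
      thApp : (f : ThFun) → Args (map th (arity f)) → Term (th (res f))
      tmApp : (f : TmOp) → Args (tmArity f) → Term (tmRes f)

    data Args : List SSort → Set where
      []  : Args []
      _∷_ : ∀ {σ σs} → Term σ → Args σs → Args (σ ∷ σs)

  value : (τ : TSort) → ⟦ τ ⟧ → Term (th τ)
  value τ v = thApp (val τ v) []

  mutual
    vars : ∀ {σ} → Term σ → List Var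
    vars (var {σ} n)  = (σ , n) ∷ []
    vars (thApp f as) = varsArgs as
    vars (tmApp f as) = varsArgs as

    varsArgs : ∀ {σs} → Args σs → List Var
    varsArgs []       = []
    varsArgs (t ∷ ts) = Data.List._++_ (vars t) (varsArgs ts)

  mutual
    data Logical : ∀ {σ} → Term σ → Set where
      lvar : ∀ {τ n} → Logical (var {th τ} n)
      lapp : ∀ {f as} → LogicalArgs as → Logical (thApp f as)

    data LogicalArgs : ∀ {σs} → Args σs → Set where
      []  : LogicalArgs []
      _∷_ : ∀ {σ σs} {t : Term σ} {ts : Args σs} →
            Logical t → LogicalArgs ts → LogicalArgs (t ∷ ts)

  LTerm : Set
  LTerm = Term (th bool)

  -- Valuations and evaluation (as a big-step relation; only terms built
  -- from theory symbols and theory variables evaluate).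

  Valuation : Set
  Valuation = (τ : TSort) → ℕ → ⟦ τ ⟧

  mutual
    data Eval (ρ : Valuation) : ∀ {τ} → Term (th τ) → ⟦ τ ⟧ → Set where
      evar : ∀ {τ n} → Eval ρ (var {th τ} n) (ρ τ n)
      eapp : ∀ {f as vs} → EvalArgs ρ (arity f) as vs →
             Eval ρ (thApp f as) (interp f vs)

    data EvalArgs (ρ : Valuation) :
         (τs : List TSort) → Args (map th τs) → All ⟦_⟧ τs → Set where
      []  : EvalArgs ρ [] [] []
      _∷_ : ∀ {τ τs t ts v vs} → Eval ρ {τ} t v → EvalArgs ρ τs ts vs →
            EvalArgs ρ (τ ∷ τs) (t ∷ ts) (v ∷ vs)

  Holds : Valuation → LTerm → Set
  Holds ρ φ = Eval ρ φ true

  Subst : Set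
  Subst = ∀ {σ} → ℕ → Term σ

  mutual
    _⟨_⟩ : ∀ {σ} → Term σ → Subst → Term σ
    var n      ⟨ δ ⟩ = δ n
    thApp f as ⟨ δ ⟩ = thApp f (as ⟨ δ ⟩*)
    tmApp f as ⟨ δ ⟩ = tmApp f (as ⟨ δ ⟩*)

    _⟨_⟩* : ∀ {σs} → Args σs → Subst → Args σs
    []       ⟨ δ ⟩* = []
    (t ∷ ts) ⟨ δ ⟩* = (t ⟨ δ ⟩) ∷ (ts ⟨ δ ⟩*)

  IsRestriction : (U : Var → Set) → Subst → Subst → Set
  IsRestriction U δ θ = ∀ σ n →
    (U (σ , n) → θ {σ} n ≡ δ {σ} n) × (¬U (σ , n) → θ {σ} n ≡ var n)
    where
      ¬U : Var → Set
      ¬U x = U x → Data.Empty.⊥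

  IsValueSubst : List ThVar → Subst → Set
  IsValueSubst xs δ =
    (∀ τ n → (τ , n) ∈ xs → Σ ⟦ τ ⟧ λ v → δ {th τ} n ≡ value τ v) ×
    (∀ σ n → (σ , n) ∉ map thv xs → δ {σ} n ≡ var n)

  WfExConstr : List ThVar → LTerm → Set
  WfExConstr xs φ = Logical φ × (∀ x → x ∈ xs → thv x ∈ vars φ)

  FVar : List ThVar → LTerm → Var → Set
  FVar xs φ x = (x ∈ vars φ) × (x ∉ map thv xs)

  SatEx : Valuation → List ThVar → LTerm → Set
  SatEx ρ xs φ = Σ Subst λ δ → IsValueSubst xs δ × Holds ρ (φ ⟨ δ ⟩)

  ValidIff : (Valuation → Set) → (Valuation → Set) → Set
  ValidIff A B = (ρ : Valuation) → A ρ ⇔ B ρ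

  record WfECTerm {σ} (X : List ThVar) (s : Term σ) (xs : List ThVar) (φ : LTerm) : Set where
    field
      wfConstr : WfExConstr xs φ
      FV⊆X     : ∀ x → FVar xs φ x → x ∈ map thv X
      X⊆Var    : ∀ x → x ∈ X → thv x ∈ vars s
      disj     : ∀ x → x ∈ xs → thv x ∉ vars s

  Satisfiable : List ThVar → LTerm → Set
  Satisfiable xs φ = Σ Valuation λ ρ → SatEx ρ xs φ

  -- Positions, subterms and replacement.
  -- Positions are lists of 0-based argument indices.

  Pos : Set
  Pos = List ℕ

  -- Repl s p o n s' :  s|_p = o  and  s[n]_p = s'
  mutual
    data Repl {τ} : ∀ {σ} → Term σ → Pos → Term τ → Term τ → Term σ → Set where
      here : ∀ {o n : Term τ} → Repl o [] o n n
      inTh : ∀ {f as i p o n as'} → ReplArgs as i p o n as' →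
             Repl (thApp f as) (i ∷ p) o n (thApp f as')
      inTm : ∀ {f as i p o n as'} → ReplArgs as i p o n as' →
             Repl (tmApp f as) (i ∷ p) o n (tmApp f as')

    data ReplArgs {τ} : ∀ {σs} → Args σs → ℕ → Pos → Term τ → Term τ → Args σs → Set where
      hd : ∀ {σ σs} {t t' : Term σ} {ts : Args σs} {p o n} →
           Repl t p o n t' → ReplArgs (t ∷ ts) zero p o n (t' ∷ ts)
      tl : ∀ {σ σs} {t : Term σ} {ts ts' : Args σs} {i p o n} →
           ReplArgs ts i p o n ts' → ReplArgs (t ∷ ts) (suc i) p o n (t ∷ ts')

  SubAt : ∀ {σ τ} → Term σ → Pos → Term τ → Set
  SubAt s p u = Repl s p u u s

  data RootXVal (X : List ThVar) : ∀ {σ} → Term σ → Set where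
    rvar : ∀ {τ n} → (τ , n) ∈ X → RootXVal X (var {th τ} n)
    rval : ∀ {τ} (v : ⟦ τ ⟧) → RootXVal X (value τ v)

  InPosXVal : ∀ {σ} → List ThVar → Term σ → Pos → Set
  InPosXVal X s p = Σ SSort λ σ' → Σ (Term σ') λ u → SubAt s p u × RootXVal X u

  -- PG-transformation.  An entry (p_i , τ_i , s|_{p_i} , w_i) records a
  -- position, the (theory) sort of the subterm there, the subterm, and
  -- the name of the fresh variable w_i of sort τ_i.

  record Entry : Set where
    constructor entry
    field
      pos : Pos
      srt : TSort
      sub : Term (th srt)
      w   : ℕ

  open Entry public

  wVar : Entry → ThVar
  wVar e = (srt e , w e)

  -- s[w_1,…,w_n]_{p_1,…,p_n}  (the positions are parallel, so successive
  -- replacement is parallel replacement)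
  data ReplAll {σ} : Term σ → List Entry → Term σ → Set where
    []  : ∀ {s} → ReplAll s [] s
    _∷_ : ∀ {s s' t e es} → Repl s (pos e) (sub e) (var (w e)) s' →
          ReplAll s' es t → ReplAll s (e ∷ es) t

  eqConstr : Entry → LTerm
  eqConstr e = thApp (eqF (srt e)) (sub e ∷ var (w e) ∷ [])

  _∧ᶜ_ : LTerm → LTerm → LTerm
  φ ∧ᶜ ψ = thApp andF (φ ∷ ψ ∷ [])

  conjPG : LTerm → List Entry → LTerm
  conjPG φ es = foldr (λ e acc → acc ∧ᶜ eqConstr e) φ es

  record IsPG {σ} (X : List ThVar) (s : Term σ) (xs : List ThVar) (φ : LTerm)
              (es : List Entry)
              (Y : List ThVar) (t : Term σ) (ys : List ThVar) (ψ : LTerm) : Set where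
    field
      subterms    : All (λ e → SubAt s (pos e) (sub e)) es
      positions   : ∀ p → (p ∈ map pos es) ⇔ InPosXVal X s p
      posDistinct : Unique (map pos es)
      wDistinct   : Unique (map wVar es)
      wFresh      : All (λ e → (thv (wVar e) ∉ vars s) × (thv (wVar e) ∉ vars φ)
                                × (wVar e ∉ xs)) es
      Y-def       : ∀ y → (y ∈ Y) ⇔ (y ∈ map wVar es)
      t-def       : ReplAll s es t
      ys-def      : ∀ y → (y ∈ ys) ⇔ ((y ∈ xs) ⊎ (y ∈ X))
      ψ-def       : ψ ≡ conjPG φ es

  IsPGSubst : List Entry → Subst → Set
  IsPGSubst es δ =
    All (λ e → δ {th (srt e)} (w e) ≡ sub e) es ×
    (∀ σ n → (σ , n) ∉ map (λ e → thv (wVar e)) es → δ {σ} n ≡ var n)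

  -- Renaming of bound variables (α-conversion) of existential
  -- constraints, needed for capture-avoiding substitution
  -- (∃y⃗.ψ)δ.
  record AlphaVariant (ys : List ThVar) (ψ : LTerm)
                      (ys' : List ThVar) (ψ' : LTerm) : Set where
    field
      ren       : Subst
      ren-bound : ∀ τ n → (τ , n) ∈ ys → Σ ℕ λ m → ren {th τ} n ≡ var m
      ren-id    : ∀ σ n → (σ , n) ∉ map thv ys → ren {σ} n ≡ var n
      ren-inj   : ∀ τ n n' m → (τ , n) ∈ ys → (τ , n') ∈ ys →
                  ren {th τ} n ≡ var m → ren {th τ} n' ≡ var m → n ≡ n'
      ren-fresh : ∀ τ n m → (τ , n) ∈ ys → ren {th τ} n ≡ var m →
                  FVar ys ψ (th τ , m) → Data.Empty.⊥
      ys'-def   : ∀ τ m → ((τ , m) ∈ ys') ⇔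
                  (Σ ℕ λ n → ((τ , n) ∈ ys) × (ren {th τ} n ≡ var m))
      ψ'-def    : ψ' ≡ ψ ⟨ ren ⟩

  CaptureFree : List ThVar → LTerm → Subst → Set
  CaptureFree ys' ψ' δ = ∀ σ n → FVar ys' ψ' (σ , n) →
    ∀ y → y ∈ ys' → thv y ∉ vars (δ {σ} n)

module Submission where

-- The conjuncts s|p = w of ψ, instantiated by σ and with the bound variables renamed, read
-- x' = x for x ∈ X (x' the renamed copy of x) and v = v for values.  Every x ∈ X occurs in s at a
-- position of Pos_{X∪Val}(s), so these equations pin each copy x' to the value of x and leave an
-- existential over the copies of x⃗ alone.  Semantically: a value substitution δ satisfies φδ
-- under ρ iff φ holds under ρ ⊙ δ, ρ updated by δ; so both sides say that φ holds under some
-- valuation agreeing with ρ on X.  The membership tests needed to build the witnessing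
-- substitutions are read off the substitutions at hand: the given value substitution for x⃗,
-- the PG substitution σ for X, and the renaming for y⃗.

open import Defs
open import Data.Bool using (true; false)
open import Data.Bool.Properties using () renaming (_≟_ to _≟𝔹_)
open import Data.Empty using (⊥-elim)
open import Data.List using (List; []; _∷_; map)
open import Data.List.Membership.Propositional using (_∈_; _∉_; find; lose)
open import Data.List.Membership.Propositional.Properties using (∈-map⁺; ∈-map⁻; ∈-++⁺ˡ; ∈-++⁺ʳ; ∈-++⁻)
open import Data.List.Relation.Unary.All using (All; []; _∷_; lookup; tabulate)
open import Data.List.Relation.Unary.Any using (Any; here; there; any?)
open import Data.Nat using (ℕ; zero; suc) renaming (_≟_ to _≟ℕ_)
open import Data.Product using (Σ; _×_; _,_; proj₁; proj₂)
open import Data.Product.Function.NonDependent.Propositional using (_×-⇔_)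
open import Data.Sum using (_⊎_; inj₁; inj₂; [_,_])
import Data.Sum as Sum
open import Data.Unit using (⊤)
open import Function using (_∘_)
open import Function.Bundles using (_⇔_; mk⇔; Equivalence)
open import Function.Construct.Identity using (⇔-id)
open import Function.Properties.Equivalence using (⇔-setoid)
open import Level using (0ℓ)
open import Relation.Nullary using (¬_; Dec; yes; no)
open import Relation.Nullary.Decidable using (decidable-stable; map′; _×-dec_; _⊎-dec_; ¬?)
open import Relation.Nullary.Negation using (¬¬-map)
open import Relation.Binary.PropositionalEquality
  using (_≡_; _≢_; refl; sym; trans; cong; cong₂; subst; module ≡-Reasoning)
import Relation.Binary.Reasoning.Setoid as SetoidReasoning

open Equivalence using (to; from)

dec¬¬ : ∀ {P Q : Set} → Dec P → (P → ¬ ¬ Q) → (Q → P) → Dec (¬ ¬ Q)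
dec¬¬ (yes p) sound complete = yes (sound p)
dec¬¬ (no ¬p) sound complete = no λ ¬¬q → ¬¬q (¬p ∘ complete)

dec¬¬-⊎ : ∀ {A B : Set} → Dec (¬ ¬ A) → Dec (¬ ¬ B) → Dec (¬ ¬ (A ⊎ B))
dec¬¬-⊎ a? b? = dec¬¬ (a? ⊎-dec b?) [ ¬¬-map inj₁ , ¬¬-map inj₂ ] (Sum.map (λ a ¬a → ¬a a) (λ b ¬b → ¬b b))

module Terms (Sg : Signature) (M : Model Sg) where
  open Theory Sg M

  _⨾_ : Subst → Subst → Subst
  (κ ⨾ κ') n = κ n ⟨ κ' ⟩

  mutual
    ⟨⟩-⨾ : ∀ {σ} (t : Term σ) (κ κ' : Subst) → t ⟨ κ ⟩ ⟨ κ' ⟩ ≡ t ⟨ κ ⨾ κ' ⟩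
    ⟨⟩-⨾ (var n)      κ κ' = refl
    ⟨⟩-⨾ (thApp f as) κ κ' = cong (thApp f) (⟨⟩*-⨾ as κ κ')
    ⟨⟩-⨾ (tmApp f as) κ κ' = cong (tmApp f) (⟨⟩*-⨾ as κ κ')

    ⟨⟩*-⨾ : ∀ {σs} (as : Args σs) (κ κ' : Subst) → as ⟨ κ ⟩* ⟨ κ' ⟩* ≡ as ⟨ κ ⨾ κ' ⟩*
    ⟨⟩*-⨾ []       κ κ' = refl
    ⟨⟩*-⨾ (t ∷ ts) κ κ' = cong₂ _∷_ (⟨⟩-⨾ t κ κ') (⟨⟩*-⨾ ts κ κ')

  mutual
    ⟨var⟩ : ∀ {σ} (t : Term σ) → t ⟨ var ⟩ ≡ t
    ⟨var⟩ (var n)      = refl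
    ⟨var⟩ (thApp f as) = cong (thApp f) (⟨var⟩* as)
    ⟨var⟩ (tmApp f as) = cong (tmApp f) (⟨var⟩* as)

    ⟨var⟩* : ∀ {σs} (as : Args σs) → as ⟨ var ⟩* ≡ as
    ⟨var⟩* []       = refl
    ⟨var⟩* (t ∷ ts) = cong₂ _∷_ (⟨var⟩ t) (⟨var⟩* ts)

  mutual
    vars-⟨⟩ : ∀ {σ} (t : Term σ) (κ : Subst) {σ' n} → (σ' , n) ∈ vars t →
              ∀ {y} → y ∈ vars (κ {σ'} n) → y ∈ vars (t ⟨ κ ⟩)
    vars-⟨⟩ (var n)      κ (here refl) y∈ = y∈
    vars-⟨⟩ (thApp f as) κ x∈ y∈ = vars*-⟨⟩ as κ x∈ y∈
    vars-⟨⟩ (tmApp f as) κ x∈ y∈ = vars*-⟨⟩ as κ x∈ y∈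

    vars*-⟨⟩ : ∀ {σs} (as : Args σs) (κ : Subst) {σ' n} → (σ' , n) ∈ varsArgs as →
               ∀ {y} → y ∈ vars (κ {σ'} n) → y ∈ varsArgs (as ⟨ κ ⟩*)
    vars*-⟨⟩ (t ∷ ts) κ x∈ y∈ with ∈-++⁻ (vars t) x∈
    ... | inj₁ x∈t  = ∈-++⁺ˡ (vars-⟨⟩ t κ x∈t y∈)
    ... | inj₂ x∈ts = ∈-++⁺ʳ (vars (t ⟨ κ ⟩)) (vars*-⟨⟩ ts κ x∈ts y∈)

  isVar? : ∀ {σ} (t : Term σ) (m : ℕ) → Dec (t ≡ var m)
  isVar? (var n) m with n ≟ℕ m
  ... | yes refl = yes refl
  ... | no n≢m   = no λ { refl → n≢m refl }
  isVar? (thApp f as) m = no λ ()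
  isVar? (tmApp f as) m = no λ ()

  data Atomic : ∀ {σ} → Term σ → Set where
    var : ∀ {τ n} → Atomic (var {th τ} n)
    val : ∀ {τ} (v : ⟦ τ ⟧) → Atomic (value τ v)

  -- The tmApp clause must come first: splitting the sort first would leave tmRes f ≟ th τ stuck.
  atomic? : ∀ {σ} (t : Term σ) → Dec (Atomic t)
  atomic? (tmApp f as)         = no λ ()
  atomic? (thApp (val τ v) []) = yes (val v)
  atomic? (thApp (op f) as)    = no λ ()
  atomic? (thApp (eqF τ) as)   = no λ ()
  atomic? (thApp andF as)      = no λ ()
  atomic? (var {th τ} n)       = yes var
  atomic? (var {tm _} n)       = no λ ()

  mutual
    repl-subterm-unique : ∀ {τ τ' σ} {s : Term σ} {p} {o n : Term τ} {s'} {o' n' : Term τ'} {s''} →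
                          Repl s p o n s' → Repl s p o' n' s'' →
                          _≡_ {A = Σ SSort Term} (τ , o) (τ' , o')
    repl-subterm-unique here     here      = refl
    repl-subterm-unique (inTh r) (inTh r') = replArgs-subterm-unique r r'
    repl-subterm-unique (inTm r) (inTm r') = replArgs-subterm-unique r r'

    replArgs-subterm-unique : ∀ {τ τ' σs} {as : Args σs} {i p} {o n : Term τ} {as'}
                                {o' n' : Term τ'} {as''} →
                              ReplArgs as i p o n as' → ReplArgs as i p o' n' as'' →
                              _≡_ {A = Σ SSort Term} (τ , o) (τ' , o')
    replArgs-subterm-unique (hd r) (hd r') = repl-subterm-unique r r'
    replArgs-subterm-unique (tl r) (tl r') = replArgs-subterm-unique r r'

  mutual
    var-subterm : ∀ {σ} (t : Term σ) {σ' n} → (σ' , n) ∈ vars t →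
                  Σ Pos λ p → SubAt t p (var {σ'} n)
    var-subterm (var n)      (here refl) = [] , here
    var-subterm (thApp f as) x∈ = let (i , p , r) = var-subtermArgs as x∈ in i ∷ p , inTh r
    var-subterm (tmApp f as) x∈ = let (i , p , r) = var-subtermArgs as x∈ in i ∷ p , inTm r

    var-subtermArgs : ∀ {σs} (as : Args σs) {σ' n} → (σ' , n) ∈ varsArgs as →
                      Σ ℕ λ i → Σ Pos λ p → ReplArgs as i p (var {σ'} n) (var n) as
    var-subtermArgs (t ∷ ts) x∈ with ∈-++⁻ (vars t) x∈
    ... | inj₁ x∈t  = let (p , r) = var-subterm t x∈t in zero , p , hd r
    ... | inj₂ x∈ts = let (i , p , r) = var-subtermArgs ts x∈ts in suc i , p , tl r

module Evaluation (Sg : Signature) (M : Model Sg) where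
  open Theory Sg M
  open Terms Sg M

  eqSem-spec : ∀ τ (a b : ⟦ τ ⟧) → (eqSem τ a b ≡ true) ⇔ (a ≡ b)
  eqSem-spec bool a b with a ≟𝔹 b
  ... | yes a≡b = mk⇔ (λ _ → a≡b) (λ _ → refl)
  ... | no  a≢b = mk⇔ (λ ()) (⊥-elim ∘ a≢b)
  eqSem-spec (base β) a b = eqI-spec β a b

  ≟-⟦_⟧ : ∀ τ (a b : ⟦ τ ⟧) → Dec (a ≡ b)
  ≟-⟦ τ ⟧ a b = map′ (to (eqSem-spec τ a b)) (from (eqSem-spec τ a b)) (eqSem τ a b ≟𝔹 true)

  Dom : SSort → Set
  Dom (th τ) = ⟦ τ ⟧
  Dom (tm _) = ⊤

  -- ρ ⊙ κ is the valuation x ↦ ⟦κ x⟧ρ; it is meaningful where κ x is atomic, and junk (d) elsewhere.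
  atomValue : Valuation → ∀ {σ} → Term σ → Dom σ → Dom σ
  atomValue ρ (thApp (val τ v) []) d = v
  atomValue ρ (var {th τ} n)       d = ρ τ n
  atomValue ρ t                    d = d

  _⊙_ : Valuation → Subst → Valuation
  (ρ ⊙ κ) τ n = atomValue ρ (κ {th τ} n) (ρ τ n)

  module _ (ρ : Valuation) where
    eval-var : ∀ {τ n v} → Eval ρ (var {th τ} n) v ⇔ (v ≡ ρ τ n)
    eval-var = mk⇔ (λ { evar → refl }) (λ { refl → evar })

    eval-atomic : ∀ {τ} {t : Term (th τ)} → Atomic t → ∀ {d v} → Eval ρ t v ⇔ (v ≡ atomValue ρ t d)
    eval-atomic var     = eval-var
    eval-atomic (val v) = mk⇔ (λ { (eapp []) → refl }) (λ { refl → eapp [] })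

    eval-thApp⁻¹ : ∀ {f as v} → Eval ρ (thApp f as) v →
                   Σ (All ⟦_⟧ (arity f)) λ vs → EvalArgs ρ (arity f) as vs × (interp f vs ≡ v)
    eval-thApp⁻¹ (eapp eas) = _ , eas , refl

    holds-∧ᶜ : ∀ {a b} → Holds ρ (a ∧ᶜ b) ⇔ (Holds ρ a × Holds ρ b)
    holds-∧ᶜ = mk⇔ split (λ (ha , hb) → eapp (ha ∷ hb ∷ []))
      where
        split : ∀ {a b} → Holds ρ (a ∧ᶜ b) → Holds ρ a × Holds ρ b
        split h with eval-thApp⁻¹ h
        ... | true  ∷ true  ∷ [] , ea ∷ eb ∷ [] , refl = ea , eb
        ... | true  ∷ false ∷ [] , _ , ()
        ... | false ∷ _     ∷ [] , _ , ()

    holds-≐ : ∀ {τ} {a b : Term (th τ)} →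
              Holds ρ (thApp (eqF τ) (a ∷ b ∷ [])) ⇔ (Σ ⟦ τ ⟧ λ v → Eval ρ a v × Eval ρ b v)
    holds-≐ {τ} = mk⇔ split join
      where
        split : ∀ {a b} → Holds ρ (thApp (eqF τ) (a ∷ b ∷ [])) → Σ ⟦ τ ⟧ λ v → Eval ρ a v × Eval ρ b v
        split h with eval-thApp⁻¹ h
        ... | x ∷ y ∷ [] , ea ∷ eb ∷ [] , x≐y with to (eqSem-spec τ x y) x≐y
        ...   | refl = x , ea , eb

        join : ∀ {a b} → Σ ⟦ τ ⟧ (λ v → Eval ρ a v × Eval ρ b v) → Holds ρ (thApp (eqF τ) (a ∷ b ∷ []))
        join (v , ea , eb) = subst (Eval ρ _) (from (eqSem-spec τ v v) refl) (eapp (ea ∷ eb ∷ []))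

    holds-conjPG-⟨⟩ : ∀ (κ : Subst) φ es →
                      Holds ρ (conjPG φ es ⟨ κ ⟩) ⇔
                      (Holds ρ (φ ⟨ κ ⟩) × All (λ e → Holds ρ (eqConstr e ⟨ κ ⟩)) es)
    holds-conjPG-⟨⟩ κ φ []       = mk⇔ (_, []) proj₁
    holds-conjPG-⟨⟩ κ φ (e ∷ es) = mk⇔
      (λ h → let (hrest , he) = to holds-∧ᶜ h ; (hφ , hes) = to IH hrest in hφ , he ∷ hes)
      (λ { (hφ , he ∷ hes) → from holds-∧ᶜ (from IH (hφ , hes) , he) })
      where IH = holds-conjPG-⟨⟩ κ φ es

  module _ (ρ ρ' : Valuation) (κ : Subst) where
    mutual
      eval-⟨⟩ : ∀ {τ} {t : Term (th τ)} → Logical t →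
                (∀ τ' n → (th τ' , n) ∈ vars t → ∀ {v} → Eval ρ (κ {th τ'} n) v ⇔ (v ≡ ρ' τ' n)) →
                ∀ {v} → Eval ρ (t ⟨ κ ⟩) v ⇔ Eval ρ' t v
      eval-⟨⟩ lvar h = mk⇔ (λ e → subst (Eval ρ' _) (sym (to (h _ _ (here refl)) e)) evar)
                           (λ { evar → from (h _ _ (here refl)) refl })
      eval-⟨⟩ (lapp {f} {as} las) h = mk⇔ (λ { (eapp eas) → eapp (to args eas) })
                                          (λ { (eapp eas) → eapp (from args eas) })
        where args = eval*-⟨⟩ (arity f) as las h

      eval*-⟨⟩ : ∀ τs (as : Args (map th τs)) → LogicalArgs as →
                 (∀ τ' n → (th τ' , n) ∈ varsArgs as → ∀ {v} → Eval ρ (κ {th τ'} n) v ⇔ (v ≡ ρ' τ' n)) →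
                 ∀ {vs} → EvalArgs ρ τs (as ⟨ κ ⟩*) vs ⇔ EvalArgs ρ' τs as vs
      eval*-⟨⟩ []       []       []         h = mk⇔ (λ { [] → [] }) (λ { [] → [] })
      eval*-⟨⟩ (τ ∷ τs) (t ∷ ts) (lt ∷ lts) h = mk⇔
        (λ { (e ∷ es) → to hd' e ∷ to tl' es })
        (λ { (e ∷ es) → from hd' e ∷ from tl' es })
        where
          hd' = eval-⟨⟩ lt (λ τ' n x∈ → h τ' n (∈-++⁺ˡ x∈))
          tl' = eval*-⟨⟩ τs ts lts (λ τ' n x∈ → h τ' n (∈-++⁺ʳ (vars t) x∈))

  eval-⟨atomic⟩ : ∀ (ρ : Valuation) (κ : Subst) {τ} {t : Term (th τ)} → Logical t →
                  (∀ τ' n → (th τ' , n) ∈ vars t → Atomic (κ {th τ'} n)) →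
                  ∀ {v} → Eval ρ (t ⟨ κ ⟩) v ⇔ Eval (ρ ⊙ κ) t v
  eval-⟨atomic⟩ ρ κ lt atomic = eval-⟨⟩ ρ (ρ ⊙ κ) κ lt (λ τ' n x∈ → eval-atomic ρ (atomic τ' n x∈))

  eval-coincide : ∀ (ρ ρ' : Valuation) {τ} {t : Term (th τ)} → Logical t →
                  (∀ τ' n → (th τ' , n) ∈ vars t → ρ τ' n ≡ ρ' τ' n) →
                  ∀ {v} → Eval ρ t v ⇔ Eval ρ' t v
  eval-coincide ρ ρ' {t = t} lt agree {v} =
    subst (λ u → Eval ρ u v ⇔ Eval ρ' t v) (⟨var⟩ t)
      (eval-⟨⟩ ρ ρ' var lt (λ τ' n x∈ → mk⇔ (λ { evar → agree τ' n x∈ })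
                                             (λ { refl → subst (Eval ρ _) (agree τ' n x∈) evar })))

  ⊙-var : ∀ (ρ : Valuation) (κ : Subst) {τ n m} → κ {th τ} n ≡ var m → (ρ ⊙ κ) τ n ≡ ρ τ m
  ⊙-var ρ κ κn≡m rewrite κn≡m = refl

  ⊙-value : ∀ (ρ : Valuation) (κ : Subst) {τ n v} → κ {th τ} n ≡ value τ v → (ρ ⊙ κ) τ n ≡ v
  ⊙-value ρ κ κn≡v rewrite κn≡v = refl

  SameValue : Valuation → Valuation → ∀ {τ} → Term (th τ) → Set
  SameValue ρ ρ' {τ} u = Σ ⟦ τ ⟧ λ v → Eval ρ u v × Eval ρ' u v

  _≈[_]_ : Valuation → List ThVar → Valuation → Set
  ρ ≈[ L ] ρ' = ∀ {τ n} → (τ , n) ∈ L → ρ τ n ≡ ρ' τ n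

module ValueSubstitutions (Sg : Signature) (M : Model Sg) where
  open Theory Sg M
  open Terms Sg M
  open Evaluation Sg M

  thv-∈⁻ : ∀ {L : List ThVar} {τ n} → (th τ , n) ∈ map thv L → (τ , n) ∈ L
  thv-∈⁻ x∈ with ∈-map⁻ thv x∈
  ... | _ , y∈ , refl = y∈

  -- Theory sorts need not have decidable equality, so membership of a
  -- sorted variable in a list is in general only decidable up to double negation.
  Dec¬¬∈ : List ThVar → Set
  Dec¬¬∈ L = ∀ τ n → Dec (¬ ¬ ((τ , n) ∈ L))

  -- A value substitution for L reveals membership in L: it moves exactly the variables of L.
  isValueSubst-test : ∀ {L : List ThVar} {δ : Subst} → IsValueSubst L δ → Dec¬¬∈ L
  isValueSubst-test {δ = δ} (onL , offL) τ n = dec¬¬ (¬? (isVar? (δ {th τ} n) n))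
    (λ δn≢n n∉ → δn≢n (offL (th τ) n (n∉ ∘ thv-∈⁻)))
    (λ n∈ → let (v , δn≡v) = onL τ n n∈ in λ δn≡n → value≢var (trans (sym δn≡v) δn≡n))
    where
      value≢var : ∀ {v m} → ¬ (value τ v ≡ var m)
      value≢var ()

  isValueSubst-atomic : ∀ {L : List ThVar} {δ : Subst} → IsValueSubst L δ → ∀ τ n → Atomic (δ {th τ} n)
  isValueSubst-atomic {δ = δ} (onL , offL) τ n = decidable-stable (atomic? (δ {th τ} n)) λ ¬atomic →
    (λ n∉ → ¬atomic (subst Atomic (sym (offL (th τ) n (n∉ ∘ thv-∈⁻))) var))
    (λ n∈ → let (v , δn≡v) = onL τ n n∈ in ¬atomic (subst Atomic (sym δn≡v) (val v)))

  isValueSubst-⊙-outside : ∀ {L : List ThVar} {δ : Subst} → IsValueSubst L δ →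
                           ∀ ρ {τ n} → (τ , n) ∉ L → (ρ ⊙ δ) τ n ≡ ρ τ n
  isValueSubst-⊙-outside {δ = δ} (_ , offL) ρ {τ} {n} n∉ = ⊙-var ρ δ (offL (th τ) n (n∉ ∘ thv-∈⁻))

  holds-⟨valueSubst⟩ : ∀ {L : List ThVar} {δ : Subst} → IsValueSubst L δ → ∀ ρ {φ} → Logical φ →
                       Holds ρ (φ ⟨ δ ⟩) ⇔ Holds (ρ ⊙ δ) φ
  holds-⟨valueSubst⟩ {δ = δ} isVS ρ lφ = eval-⟨atomic⟩ ρ δ lφ (λ τ n _ → isValueSubst-atomic isVS τ n)

  module _ {L : List ThVar} (L? : Dec¬¬∈ L) where
    valueSubst : Valuation → Subst
    valueSubst ν {th τ} n with L? τ n
    ... | yes _ = value τ (ν τ n)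
    ... | no  _ = var n
    valueSubst ν {tm _} n = var n

    valueSubst-on : ∀ ν {τ n} → (τ , n) ∈ L → valueSubst ν {th τ} n ≡ value τ (ν τ n)
    valueSubst-on ν {τ} {n} n∈ with L? τ n
    ... | yes _    = refl
    ... | no ¬¬¬n∈ = ⊥-elim (¬¬¬n∈ λ n∉ → n∉ n∈)

    valueSubst-isValueSubst : ∀ ν → IsValueSubst L (valueSubst ν)
    valueSubst-isValueSubst ν = (λ τ n n∈ → ν τ n , valueSubst-on ν n∈) , off
      where
        off : ∀ σ n → (σ , n) ∉ map thv L → valueSubst ν {σ} n ≡ var n
        off (tm _) n n∉ = refl
        off (th τ) n n∉ with L? τ n
        ... | yes ¬¬n∈ = ⊥-elim (¬¬n∈ (n∉ ∘ ∈-map⁺ thv))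
        ... | no  _    = refl

    valueSubst-⊙ : ∀ ν ρ {τ n} → (τ , n) ∈ L → (ρ ⊙ valueSubst ν) τ n ≡ ν τ n
    valueSubst-⊙ ν ρ n∈ = ⊙-value ρ (valueSubst ν) (valueSubst-on ν n∈)

  isValueSubst-fixes : ∀ {L : List ThVar} {δ : Subst} → IsValueSubst L δ →
                       ∀ {τ} {u : Term (th τ)} → Atomic u → (∀ y → y ∈ L → thv y ∉ vars u) → u ⟨ δ ⟩ ≡ u
  isValueSubst-fixes (_ , offL) {τ} (var {n = n}) fresh =
    offL (th τ) n λ n∈ → let (y , y∈ , n≡y) = ∈-map⁻ thv n∈ in fresh y y∈ (here (sym n≡y))
  isValueSubst-fixes isVS (val v) fresh = refl

module AlphaRenaming (Sg : Signature) (M : Model Sg) where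
  open Theory Sg M
  open Terms Sg M
  open ValueSubstitutions Sg M

  module Renaming {ys ψ ys' ψ'} (av : AlphaVariant ys ψ ys' ψ') where
    open AlphaVariant av

    ren-∈ys' : ∀ {τ n m} → (τ , n) ∈ ys → ren {th τ} n ≡ var m → (τ , m) ∈ ys'
    ren-∈ys' {τ} {n} {m} n∈ n↦m = from (ys'-def τ m) (n , n∈ , n↦m)

    module Inverse (ys? : Dec¬¬∈ ys) where
      Preimage : TSort → ℕ → Set
      Preimage τ m = Σ ℕ λ n → ¬ ¬ ((τ , n) ∈ ys) × (ren {th τ} n ≡ var m)

      -- A preimage lies in ys only up to ¬¬, but searching ys is decidable, hence stable.
      preimage? : ∀ τ m → Dec (Preimage τ m)
      preimage? τ m = map′ (λ found → let (y , _ , pre) = find found in proj₂ y , pre)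
                           (λ (n , ¬¬n∈ , n↦m) →
                              decidable-stable search (¬¬-map (λ n∈ → lose n∈ (¬¬n∈ , n↦m)) ¬¬n∈))
                           search
        where
          search = any? (λ y → ys? τ (proj₂ y) ×-dec isVar? (ren {th τ} (proj₂ y)) m) ys

      preimage-unique : ∀ {τ n m} ((n' , _) : Preimage τ m) →
                        (τ , n) ∈ ys → ren {th τ} n ≡ var m → n' ≡ n
      preimage-unique {τ} {n} {m} (n' , ¬¬n'∈ , n'↦m) n∈ n↦m =
        decidable-stable (n' ≟ℕ n) (¬¬-map (λ n'∈ → ren-inj τ n' n m n'∈ n∈ n'↦m n↦m) ¬¬n'∈)

      ys'-test : Dec¬¬∈ ys'
      ys'-test τ m = dec¬¬ (preimage? τ m)
        (λ (n , ¬¬n∈ , n↦m) → ¬¬-map (λ n∈ → ren-∈ys' n∈ n↦m) ¬¬n∈)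
        (λ m∈ → let (n , n∈ , n↦m) = to (ys'-def τ m) m∈ in n , (λ n∉ → n∉ n∈) , n↦m)

      _∘ren⁻¹ : Valuation → Valuation
      (ν ∘ren⁻¹) τ m with preimage? τ m
      ... | yes (n , _) = ν τ n
      ... | no  _       = ν τ m

      ∘ren⁻¹-correct : ∀ ν {τ n m} → (τ , n) ∈ ys → ren {th τ} n ≡ var m → (ν ∘ren⁻¹) τ m ≡ ν τ n
      ∘ren⁻¹-correct ν {τ} {n} {m} n∈ n↦m with preimage? τ m
      ... | yes pre   = cong (ν τ) (preimage-unique pre n∈ n↦m)
      ... | no  ¬pre  = ⊥-elim (¬pre (n , (λ n∉ → n∉ n∈) , n↦m))

module PGTransformation (Sg : Signature) (M : Model Sg) where
  open Theory Sg M
  open Terms Sg M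
  open Evaluation Sg M
  open ValueSubstitutions Sg M

  root-atomic : ∀ {X τ} {u : Term (th τ)} → RootXVal X u → Atomic u
  root-atomic (rvar _) = var
  root-atomic (rval v) = val v

  root-logical : ∀ {X τ} {u : Term (th τ)} → RootXVal X u → Logical u
  root-logical (rvar _) = lvar
  root-logical (rval v) = lapp []

  root-vars : ∀ {X τ τ' n} {u : Term (th τ)} → RootXVal X u → (th τ' , n) ∈ vars u → (τ' , n) ∈ X
  root-vars (rvar n∈X) (here refl) = n∈X

  root-agree : ∀ {X τ} {u : Term (th τ)} → RootXVal X u → ∀ {ρ ρ'} → ρ' ≈[ X ] ρ → SameValue ρ' ρ u
  root-agree (rvar {τ} {n} n∈X) {ρ} agree = ρ τ n , subst (Eval _ _) (agree n∈X) evar , evar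
  root-agree (rval v)         agree = v , eapp [] , eapp []

  w∈conjPG : ∀ φ {e} es → e ∈ es → thv (wVar e) ∈ vars (conjPG φ es)
  w∈conjPG φ {e} (e' ∷ es) (here refl) =
    ∈-++⁺ʳ (vars (conjPG φ es)) (∈-++⁺ˡ (∈-++⁺ʳ (vars (sub e)) (here refl)))
  w∈conjPG φ (e' ∷ es) (there e∈) = ∈-++⁺ˡ (w∈conjPG φ es e∈)

  module Facts {σ} {X : List ThVar} {s : Term σ} {xs φ es Y t ys ψ}
               (wf : WfECTerm X s xs φ) (pg : IsPG X s xs φ es Y t ys ψ) where
    open WfECTerm wf
    open IsPG pg

    entry-root : ∀ {e} → e ∈ es → RootXVal X (sub e)
    entry-root {e} e∈ =
      let (_ , _ , at-pos , root) = to (positions (pos e)) (∈-map⁺ pos e∈)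
      in subst (RootXVal X ∘ proj₂) (repl-subterm-unique at-pos (lookup subterms e∈)) root

    X-covered : ∀ {τ n} → (τ , n) ∈ X → Σ Pos λ p → Σ ℕ λ w' → entry p τ (var n) w' ∈ es
    X-covered {τ} {n} n∈X with var-subterm s (X⊆Var _ n∈X)
    ... | p , at-p with ∈-map⁻ pos (from (positions p) (th τ , var n , at-p , rvar n∈X))
    ...   | e , e∈ , refl = entry-of e∈ (repl-subterm-unique at-p (lookup subterms e∈))
      where
        entry-of : ∀ {e} → e ∈ es → _≡_ {A = Σ SSort Term} (th τ , var n) (th (srt e) , sub e) →
                   Σ Pos λ p → Σ ℕ λ w' → entry p τ (var n) w' ∈ es
        entry-of {entry p _ _ w'} e∈ refl = p , w' , e∈

    X-disjoint-xs : ∀ {x} → x ∈ X → x ∉ xs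
    X-disjoint-xs x∈X x∈xs = disj _ x∈xs (X⊆Var _ x∈X)

    φ-vars : ∀ {τ n} → (th τ , n) ∈ vars φ → ¬ ¬ ((τ , n) ∈ xs ⊎ (τ , n) ∈ X)
    φ-vars x∈ ¬either = ¬either (inj₂ (thv-∈⁻ (FV⊆X _ (x∈ , ¬either ∘ inj₁ ∘ thv-∈⁻))))

    -- Agreement is an equation between values, which have decidable equality, hence stable.
    φ-coincide : ∀ {ρ ρ'} → ρ ≈[ xs ] ρ' → ρ ≈[ X ] ρ' → Holds ρ φ → Holds ρ' φ
    φ-coincide {ρ} {ρ'} on-xs on-X = to (eval-coincide ρ ρ' (proj₁ wfConstr) λ τ n x∈ →
      decidable-stable (≟-⟦ τ ⟧ _ _) (¬¬-map [ on-xs , on-X ] (φ-vars x∈)))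

    entries-agree⇔ : ∀ ρ ρ' → All (λ e → SameValue ρ' ρ (sub e)) es ⇔ (ρ' ≈[ X ] ρ)
    entries-agree⇔ ρ ρ' = mk⇔ agree (λ agree → tabulate λ e∈ → root-agree (entry-root e∈) agree)
      where
        agree : All (λ e → SameValue ρ' ρ (sub e)) es → ρ' ≈[ X ] ρ
        agree all n∈X with X-covered n∈X
        ... | _ , _ , e∈ with lookup all e∈
        ...   | _ , evar , e' = to (eval-var ρ) e'

    w∉ys : ∀ {e} → e ∈ es → thv (wVar e) ∉ map thv ys
    w∉ys e∈ w∈ with lookup wFresh e∈ | to (ys-def _) (thv-∈⁻ w∈)
    ... | _ , _ , w∉xs | inj₁ w∈xs = w∉xs w∈xs
    ... | w∉s , _ , _  | inj₂ w∈X  = w∉s (X⊆Var _ w∈X)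

    w∈ψ : ∀ {e} → e ∈ es → thv (wVar e) ∈ vars ψ
    w∈ψ e∈ = subst (λ ψ → _ ∈ vars ψ) (sym ψ-def) (w∈conjPG φ es e∈)

    ys-test : Dec¬¬∈ xs → Dec¬¬∈ X → Dec¬¬∈ ys
    ys-test xs? X? τ n =
      map′ (¬¬-map (from (ys-def _))) (¬¬-map (to (ys-def _))) (dec¬¬-⊎ (xs? τ n) (X? τ n))

    -- (τ , n) ∈ X iff δ, read at sort τ, maps some w_i ≠ n to var n: δ can be queried at any
    -- sort, whereas the sorts of the entries cannot be compared with τ.
    X-test : ∀ {δ : Subst} → IsPGSubst es δ → Dec¬¬∈ X
    X-test {δ} (δ-w , δ-off) τ n =
      dec¬¬ (any? (λ e → isVar? (δ {th τ} (w e)) n ×-dec ¬? (w e ≟ℕ n)) es)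
            (λ found → let (e , _ , δw≡n , w≢n) = find found in sound δw≡n w≢n)
            complete
      where
        complete : (τ , n) ∈ X → Any (λ e → δ {th τ} (w e) ≡ var n × w e ≢ n) es
        complete n∈X with X-covered n∈X
        ... | _ , _ , e∈ = lose e∈ (lookup δ-w e∈ , λ { refl → proj₁ (lookup wFresh e∈) (X⊆Var _ n∈X) })

        sound : ∀ {w'} → δ {th τ} w' ≡ var n → w' ≢ n → ¬ ¬ ((τ , n) ∈ X)
        sound {w'} δw≡n w≢n n∉X = w≢n (var-injective (trans (sym (δ-off (th τ) w' is-w)) δw≡n))
          where
            is-w : (th τ , w') ∉ map (λ e → thv (wVar e)) es
            is-w w∈ with ∈-map⁻ (λ e → thv (wVar e)) w∈
            ... | entry _ _ _ _ , e∈ , refl =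
              let root = subst (RootXVal X) (trans (sym (lookup δ-w e∈)) δw≡n) (entry-root e∈)
              in n∉X (root-vars root (here refl))
            var-injective : ∀ {m m'} → var {th τ} m ≡ var m' → m ≡ m'
            var-injective refl = refl

module PGEquivalence (Sg : Signature) (M : Model Sg) where
  open Theory Sg M
  open Terms Sg M
  open Evaluation Sg M
  open ValueSubstitutions Sg M
  open AlphaRenaming Sg M
  open PGTransformation Sg M

  module Proof {σ} {X : List ThVar} {s : Term σ} {xs φ} (wf : WfECTerm X s xs φ) (sat : Satisfiable xs φ)
           {es Y t ys ψ} (pg : IsPG X s xs φ es Y t ys ψ) {δ : Subst} (pgs : IsPGSubst es δ)
           {ys' ψ'} (av : AlphaVariant ys ψ ys' ψ') (cf : CaptureFree ys' ψ' δ)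
           {θ : Subst} (res : IsRestriction (FVar ys' ψ') δ θ) where
    open Facts wf pg
    open WfECTerm wf
    open IsPG pg
    open AlphaVariant av
    open Renaming av

    xs⊆ys : ∀ {x} → x ∈ xs → x ∈ ys
    xs⊆ys = from (ys-def _) ∘ inj₁

    X⊆ys : ∀ {x} → x ∈ X → x ∈ ys
    X⊆ys = from (ys-def _) ∘ inj₂

    ren-w : ∀ {e} → e ∈ es → ren {th (srt e)} (w e) ≡ var (w e)
    ren-w e∈ = ren-id _ _ (w∉ys e∈)

    w-free : ∀ {e} → e ∈ es → FVar ys' ψ' (thv (wVar e))
    w-free e∈ = w∈ψ' , w∉ys'
      where
        w∈ψ' = subst (λ ψ' → _ ∈ vars ψ') (sym ψ'-def)
                     (vars-⟨⟩ ψ ren (w∈ψ e∈) (subst (λ u → _ ∈ vars u) (sym (ren-w e∈)) (here refl)))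
        w∉ys' = λ w∈ → let (n , n∈ , n↦w) = to (ys'-def _ _) (thv-∈⁻ w∈)
                       in ren-fresh _ n _ n∈ n↦w (w∈ψ e∈ , w∉ys e∈)

    θ-w : ∀ {e} → e ∈ es → θ {th (srt e)} (w e) ≡ sub e
    θ-w e∈ = trans (proj₁ (res _ _) (w-free e∈)) (lookup (proj₁ pgs) e∈)

    θ-ys' : ∀ {τ m} → (τ , m) ∈ ys' → θ {th τ} m ≡ var m
    θ-ys' m∈ = proj₂ (res _ _) λ (_ , m∉) → m∉ (∈-map⁺ thv m∈)

    module Instance (δ₂ : Subst) (isVS₂ : IsValueSubst ys' δ₂) where
      κ : Subst
      κ = (ren ⨾ θ) ⨾ δ₂

      -- Capture-freeness is what keeps δ₂ off the subterms s|p substituted by θ.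
      κ-w : ∀ {e} → e ∈ es → κ {th (srt e)} (w e) ≡ sub e
      κ-w {e} e∈ = begin
        ren (w e) ⟨ θ ⟩ ⟨ δ₂ ⟩ ≡⟨ cong (λ u → u ⟨ θ ⟩ ⟨ δ₂ ⟩) (ren-w e∈) ⟩
        θ (w e) ⟨ δ₂ ⟩         ≡⟨ cong (_⟨ δ₂ ⟩) (θ-w e∈) ⟩
        sub e ⟨ δ₂ ⟩           ≡⟨ isValueSubst-fixes isVS₂ (root-atomic (entry-root e∈)) fresh ⟩
        sub e                  ∎
        where
          open ≡-Reasoning
          fresh : ∀ y → y ∈ ys' → thv y ∉ vars (sub e)
          fresh y y∈ = cf _ _ (w-free e∈) y y∈ ∘ subst (λ u → thv y ∈ vars u) (sym (lookup (proj₁ pgs) e∈))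

      κ-ys : ∀ {τ n m} → (τ , n) ∈ ys → ren {th τ} n ≡ var m → κ {th τ} n ≡ δ₂ m
      κ-ys n∈ n↦m = trans (cong (λ u → u ⟨ θ ⟩ ⟨ δ₂ ⟩) n↦m) (cong (_⟨ δ₂ ⟩) (θ-ys' (ren-∈ys' n∈ n↦m)))

      κ-atomic-ys : ∀ {τ n} → (τ , n) ∈ ys → Atomic (κ {th τ} n)
      κ-atomic-ys {τ} {n} n∈ = let (m , n↦m) = ren-bound τ n n∈ in
        subst Atomic (sym (κ-ys n∈ n↦m)) (isValueSubst-atomic isVS₂ τ m)

      κ-atomic-φ : ∀ τ n → (th τ , n) ∈ vars φ → Atomic (κ {th τ} n)
      κ-atomic-φ τ n x∈ = decidable-stable (atomic? _) (¬¬-map (κ-atomic-ys ∘ [ xs⊆ys , X⊆ys ]) (φ-vars x∈))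

      ψ'-instance : ψ' ⟨ θ ⟩ ⟨ δ₂ ⟩ ≡ conjPG φ es ⟨ κ ⟩
      ψ'-instance = begin
        ψ' ⟨ θ ⟩ ⟨ δ₂ ⟩
          ≡⟨ cong (λ u → u ⟨ θ ⟩ ⟨ δ₂ ⟩) (trans ψ'-def (cong (_⟨ ren ⟩) ψ-def)) ⟩
        conjPG φ es ⟨ ren ⟩ ⟨ θ ⟩ ⟨ δ₂ ⟩
          ≡⟨ cong (_⟨ δ₂ ⟩) (⟨⟩-⨾ (conjPG φ es) ren θ) ⟩
        conjPG φ es ⟨ ren ⨾ θ ⟩ ⟨ δ₂ ⟩
          ≡⟨ ⟨⟩-⨾ (conjPG φ es) (ren ⨾ θ) δ₂ ⟩
        conjPG φ es ⟨ κ ⟩ ∎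
        where open ≡-Reasoning

      holds-entry : ∀ ρ {e} → e ∈ es →
                    Holds ρ (eqConstr e ⟨ κ ⟩) ⇔ SameValue (ρ ⊙ κ) ρ (sub e)
      holds-entry ρ {e} e∈ = begin
        Holds ρ (eqConstr e ⟨ κ ⟩)
          ≡⟨ cong (λ u → Holds ρ (thApp (eqF (srt e)) (sub e ⟨ κ ⟩ ∷ u ∷ []))) (κ-w e∈) ⟩
        Holds ρ (thApp (eqF (srt e)) (sub e ⟨ κ ⟩ ∷ sub e ∷ []))
          ≈⟨ holds-≐ ρ ⟩
        (Σ ⟦ srt e ⟧ λ v → Eval ρ (sub e ⟨ κ ⟩) v × Eval ρ (sub e) v)
          ≈⟨ mk⇔ (λ (v , a , b) → v , to instantiate a , b) (λ (v , a , b) → v , from instantiate a , b) ⟩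
        SameValue (ρ ⊙ κ) ρ (sub e) ∎
        where
          open SetoidReasoning (⇔-setoid 0ℓ)
          root = entry-root e∈
          instantiate : ∀ {v} → Eval ρ (sub e ⟨ κ ⟩) v ⇔ Eval (ρ ⊙ κ) (sub e) v
          instantiate = eval-⟨atomic⟩ ρ κ (root-logical root) λ _ _ x∈ → κ-atomic-ys (X⊆ys (root-vars root x∈))

      holds-instance : ∀ ρ → Holds ρ (ψ' ⟨ θ ⟩ ⟨ δ₂ ⟩) ⇔ (Holds (ρ ⊙ κ) φ × (ρ ⊙ κ) ≈[ X ] ρ)
      holds-instance ρ = begin
        Holds ρ (ψ' ⟨ θ ⟩ ⟨ δ₂ ⟩)
          ≡⟨ cong (Holds ρ) ψ'-instance ⟩
        Holds ρ (conjPG φ es ⟨ κ ⟩)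
          ≈⟨ holds-conjPG-⟨⟩ ρ κ φ es ⟩
        (Holds ρ (φ ⟨ κ ⟩) × All (λ e → Holds ρ (eqConstr e ⟨ κ ⟩)) es)
          ≈⟨ eval-⟨atomic⟩ ρ κ (proj₁ wfConstr) κ-atomic-φ ×-⇔ entries ⟩
        (Holds (ρ ⊙ κ) φ × All (λ e → SameValue (ρ ⊙ κ) ρ (sub e)) es)
          ≈⟨ ⇔-id _ ×-⇔ entries-agree⇔ ρ (ρ ⊙ κ) ⟩
        (Holds (ρ ⊙ κ) φ × (ρ ⊙ κ) ≈[ X ] ρ) ∎
        where
          open SetoidReasoning (⇔-setoid 0ℓ)
          entries : All (λ e → Holds ρ (eqConstr e ⟨ κ ⟩)) es ⇔
                    All (λ e → SameValue (ρ ⊙ κ) ρ (sub e)) es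
          entries = mk⇔ (λ hs → tabulate λ e∈ → to (holds-entry ρ e∈) (lookup hs e∈))
                        (λ hs → tabulate λ e∈ → from (holds-entry ρ e∈) (lookup hs e∈))

    forward : ∀ ρ {δ₁ : Subst} → IsValueSubst xs δ₁ → Holds ρ (φ ⟨ δ₁ ⟩) → SatEx ρ ys' (ψ' ⟨ θ ⟩)
    forward ρ {δ₁} isVS₁ h₁ = δ₂ , isVS₂ , from (holds-instance ρ) (φ-coincide on-xs on-X hφ , agree-X)
      where
        open Inverse (ys-test (isValueSubst-test isVS₁) (X-test pgs))
        ρ₁ = ρ ⊙ δ₁
        δ₂ = valueSubst ys'-test (ρ₁ ∘ren⁻¹)
        isVS₂ = valueSubst-isValueSubst ys'-test (ρ₁ ∘ren⁻¹)
        open Instance δ₂ isVS₂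

        agree-ys : (ρ ⊙ κ) ≈[ ys ] ρ₁
        agree-ys {τ} {n} n∈ = let (m , n↦m) = ren-bound τ n n∈ in
          trans (⊙-value ρ κ (trans (κ-ys n∈ n↦m) (valueSubst-on ys'-test _ (ren-∈ys' n∈ n↦m))))
                (∘ren⁻¹-correct ρ₁ n∈ n↦m)

        hφ = to (holds-⟨valueSubst⟩ isVS₁ ρ (proj₁ wfConstr)) h₁
        on-xs : ρ₁ ≈[ xs ] (ρ ⊙ κ)
        on-xs = sym ∘ agree-ys ∘ xs⊆ys
        on-X : ρ₁ ≈[ X ] (ρ ⊙ κ)
        on-X = sym ∘ agree-ys ∘ X⊆ys
        agree-X : (ρ ⊙ κ) ≈[ X ] ρ
        agree-X n∈X = trans (agree-ys (X⊆ys n∈X)) (isValueSubst-⊙-outside isVS₁ ρ (X-disjoint-xs n∈X))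

    -- The satisfiability hypothesis serves only to decide membership in xs.
    backward : ∀ ρ {δ₂ : Subst} → IsValueSubst ys' δ₂ → Holds ρ (ψ' ⟨ θ ⟩ ⟨ δ₂ ⟩) → SatEx ρ xs φ
    backward ρ {δ₂} isVS₂ h₂ =
      δ₁ , isVS₁ , from (holds-⟨valueSubst⟩ isVS₁ ρ (proj₁ wfConstr)) (φ-coincide on-xs on-X hφ)
      where
        open Instance δ₂ isVS₂
        xs? = isValueSubst-test (proj₁ (proj₂ (proj₂ sat)))
        ρ₂ = ρ ⊙ κ
        δ₁ = valueSubst xs? ρ₂
        isVS₁ = valueSubst-isValueSubst xs? ρ₂
        hφ = proj₁ (to (holds-instance ρ) h₂)
        agree-X = proj₂ (to (holds-instance ρ) h₂)

        on-xs : ρ₂ ≈[ xs ] (ρ ⊙ δ₁)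
        on-xs n∈ = sym (valueSubst-⊙ xs? ρ₂ ρ n∈)
        on-X : ρ₂ ≈[ X ] (ρ ⊙ δ₁)
        on-X n∈X = trans (agree-X n∈X) (sym (isValueSubst-⊙-outside isVS₁ ρ (X-disjoint-xs n∈X)))

lemma7 : (Sg : Signature) (M : Model Sg) →
    let open Theory Sg M in
    ∀ {σ} (X : List ThVar) (s : Term σ) (xs : List ThVar) (φ : LTerm) →
    WfECTerm X s xs φ →
    Satisfiable xs φ →
    (es : List Entry) (Y : List ThVar) (t : Term σ) (ys : List ThVar) (ψ : LTerm) →
    IsPG X s xs φ es Y t ys ψ →
    (δ : Subst) → IsPGSubst es δ →
    (ys' : List ThVar) (ψ' : LTerm) → AlphaVariant ys ψ ys' ψ' → CaptureFree ys' ψ' δ →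
    (θ : Subst) → IsRestriction (FVar ys' ψ') δ θ →
    ValidIff (λ ρ → SatEx ρ xs φ) (λ ρ → SatEx ρ ys' (ψ' ⟨ θ ⟩))
lemma7 Sg M X s xs φ wf sat es Y t ys ψ pg δ pgs ys' ψ' av cf θ res ρ =
  mk⇔ (λ (_ , isVS₁ , h₁) → forward ρ isVS₁ h₁) (λ (_ , isVS₂ , h₂) → backward ρ isVS₂ h₂)
  where open PGEquivalence.Proof Sg M wf sat pg pgs av cf res
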